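{- Let $E=[E,\leq,\varepsilon]$ be a heap in $H(P,\mathcal{C})$ whose concurrency subgraph contains no circuits, and let $[a,b]$ be a minimal balanced subinterval of $E$. Let $c\in S_{[a,b]}$, and let $a'$ (respectively $b'$) be the minimal (respectively maximal) element of $S_{[a,b]}$ with label $\varepsilon(c)$. Then $a<a'$ and $b'<b$ are covering relations in $E$.
   Context: $P$ is a set with a symmetric reflexive relation $\mathcal{C}$. A labelled heap with pieces in $P$ is a triple $(E,\leq,\varepsilon)$ with $(E,\leq)$ a finite poset and $\varepsilon:E\to P$ such that: (1) if $\varepsilon(\alpha)\,\mathcal{C}\,\varepsilon(\beta)$ then $\alpha,\beta$ are comparable; (2) $\leq$ is the transitive closure of the relation: $\alpha\leq\beta$ and $\varepsilon(\alpha)\,\mathcal{C}\,\varepsilon(\beta)$. A heap is a labelled heap up to label-preserving poset isomorphism; $H(P,\mathcal{C})$ is the set of heaps; $\varepsilon(x)$ is the label of $x$. The concurrency subgraph of $E$ is the simple graph on $\{\varepsilon(x):x\in E\}$ with an edge between $v\neq w$ iff $v\,\mathcal{C}\,w$; a circuit is a cycle. $a<b$ is a covering relation if no $c$ satisfies $a<c<b$. For $a\leq b$, $[a,b]=\{x:a\leq x\leq b\}$; it is a minimal balanced subinterval if $a\neq b$, $\varepsilon(a)=\varepsilon(b)$, and no $c\in[a,b]$ other than $a,b$ has label $\varepsilon(a)$. $S_{[a,b]}=\{c\in[a,b]:\varepsilon(c)\neq\varepsilon(a)\text{ and }\varepsilon(a)\,\mathcal{C}\,\varepsilon(c)\}$.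 -}

module Defs where

open import Data.Nat using (ℕ; suc)
open import Data.Fin using (Fin; zero; suc; inject₁; fromℕ)
open import Data.Product using (Σ; ∃; _×_; _,_)
open import Data.Sum using (_⊎_)
open import Relation.Nullary using (¬_)
open import Relation.Binary.PropositionalEquality using (_≡_; _≢_)
open import Relation.Binary.Structures using (IsPartialOrder)
open import Relation.Binary.Construct.Closure.Transitive using (TransClosure)
open import Function.Definitions using (Injective)

record LabelledHeap (P : Set) (C : P → P → Set) : Set₁ where
  field
    n          : ℕ
    _≤_        : Fin n → Fin n → Set
    isPartialOrder : IsPartialOrder _≡_ _≤_
    ε          : Fin n → P
    comparable : ∀ α β → C (ε α) (ε β) → α ≤ β ⊎ β ≤ α
    ≤⇒closure  : ∀ {α β} → α ≤ β →
                 TransClosure (λ x y → x ≤ y × C (ε x) (ε y)) α β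
    closure⇒≤  : ∀ {α β} →
                 TransClosure (λ x y → x ≤ y × C (ε x) (ε y)) α β → α ≤ β

module _ {P : Set} {C : P → P → Set} (E : LabelledHeap P C) where
  open LabelledHeap E

  _<_ : Fin n → Fin n → Set
  x < y = x ≤ y × x ≢ y

  Covers : Fin n → Fin n → Set
  Covers x y = x < y × (∀ z → ¬ (x < z × z < y))

  -- vertices of the concurrency subgraph: labels occurring in E
  IsVertex : P → Set
  IsVertex v = ∃ λ x → ε x ≡ v

  Edge : P → P → Set
  Edge v w = v ≢ w × C v w

  -- a circuit (cycle) of length m+3 in the concurrency subgraph:
  -- pairwise distinct vertices v₀,…,v_{m+2}, consecutive ones adjacent,
  -- and v_{m+2} adjacent to v₀
  record Circuit (m : ℕ) : Set where
    field
      v        : Fin (suc (suc (suc m))) → P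
      distinct : Injective _≡_ _≡_ v
      vertex   : ∀ i → IsVertex (v i)
      step     : ∀ (i : Fin (suc (suc m))) → Edge (v (inject₁ i)) (v (suc i))
      close    : Edge (v (fromℕ (suc (suc m)))) (v zero)

  NoCircuits : Set
  NoCircuits = ∀ m → ¬ Circuit m

  MinimalBalanced : Fin n → Fin n → Set
  MinimalBalanced a b =
    a ≤ b × a ≢ b × ε a ≡ ε b ×
    (∀ c → a ≤ c → c ≤ b → ε c ≡ ε a → c ≡ a ⊎ c ≡ b)

  InS : Fin n → Fin n → Fin n → Set
  InS a b c = a ≤ c × c ≤ b × ε c ≢ ε a × C (ε a) (ε c)

module Submission where

-- Suppose a < z < a'.  By condition (2) the chains a ≤ z and z ≤ a' unfold into steps
-- between elements with concurrent labels, i.e. walks in the concurrency graph, which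
-- together lead from ε a to ε a'.  Minimality of [a,b] and of a' force every step inside
-- [a,a'] between the labels ε a and ε a' to be the step from a to a' itself, which a chain
-- through z never takes.  So ε a and ε a' are joined by an edge and by a walk avoiding
-- it, which yields a circuit; walks are shortened to simple paths under double negation,
-- which is all a contradiction needs.  The covering b' < b is the same statement in the
-- opposite heap.

open import Defs
open import Data.Nat using (ℕ; zero; suc)
open import Data.Fin using (Fin; zero; suc; inject₁; fromℕ; _≟_)
open import Data.Product using (∃; _×_; _,_; proj₁; proj₂)
open import Data.Sum using (_⊎_; inj₁; inj₂; swap)
open import Data.Empty using (⊥-elim)
open import Function using (flip; _∘_)
open import Effect.Monad using (RawMonad)
open import Level using (0ℓ)
open import Relation.Nullary using (¬_; Dec; yes; no)
open import Relation.Nullary.Negation using (¬¬-Monad; ¬¬-map)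
open import Relation.Nullary.Decidable using (¬¬-excluded-middle)
open import Relation.Binary.PropositionalEquality
  using (_≡_; _≢_; refl; sym; trans; subst; cong; ≢-sym)
open import Relation.Binary.Definitions using (Reflexive; Symmetric)
open import Relation.Binary.Structures using (IsPartialOrder)
import Relation.Binary.Construct.Flip.EqAndOrd as Flip
open import Relation.Binary.Construct.Closure.Transitive using (TransClosure; [_]; _∷_; _∷ʳ_)
open LabelledHeap
open RawMonad (¬¬-Monad {a = 0ℓ}) using (_>>=_)

reverse : {A : Set} {R S : A → A → Set} → (∀ {x y} → R x y → S y x) →
          ∀ {x y} → TransClosure R x y → TransClosure S y x
reverse f [ r ]    = [ f r ]
reverse f (r ∷ rs) = reverse f rs ∷ʳ f r

module Heaps {P : Set} {C : P → P → Set} (C-sym : Symmetric C) where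

  Edge-sym : (E : LabelledHeap P C) → ∀ {v w} → Edge E v w → Edge E w v
  Edge-sym E (v≢w , vCw) = ≢-sym v≢w , C-sym vCw

  _ᵒᵖ : LabelledHeap P C → LabelledHeap P C
  E ᵒᵖ = record
    { n              = n E
    ; _≤_            = flip (_≤_ E)
    ; isPartialOrder = Flip.isPartialOrder (isPartialOrder E)
    ; ε              = ε E
    ; comparable     = λ α β → swap ∘ comparable E α β
    ; ≤⇒closure      = reverse (λ (x≤y , xCy) → x≤y , C-sym xCy) ∘ ≤⇒closure E
    ; closure⇒≤      = closure⇒≤ E ∘ reverse (λ (x≤y , xCy) → x≤y , C-sym xCy)
    }

  module _ (E : LabelledHeap P C) where

    noCircuitsᵒᵖ : NoCircuits E → NoCircuits (E ᵒᵖ)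
    noCircuitsᵒᵖ acyclic m circuit = acyclic m record
      { v = v ; distinct = distinct ; vertex = vertex ; step = step ; close = close }
      where open Circuit circuit

    minimalBalancedᵒᵖ : ∀ {a b} → MinimalBalanced E a b → MinimalBalanced (E ᵒᵖ) b a
    minimalBalancedᵒᵖ (a≤b , a≢b , εa≡εb , ends) =
      a≤b , ≢-sym a≢b , sym εa≡εb ,
      λ c b≥c c≥a εc≡εb → swap (ends c c≥a b≥c (trans εc≡εb (sym εa≡εb)))

    -- Since (E ᵒᵖ) ᵒᵖ is definitionally E, these two lemmas also transport back.

    inSᵒᵖ : ∀ {a b x} → ε E a ≡ ε E b → InS E a b x → InS (E ᵒᵖ) b a x
    inSᵒᵖ {x = x} εa≡εb (a≤x , x≤b , εx≢εa , εaCεx) =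
      x≤b , a≤x , (λ εx≡εb → εx≢εa (trans εx≡εb (sym εa≡εb))) , subst (λ p → C p (ε E x)) εa≡εb εaCεx

    coversᵒᵖ : ∀ {x y} → Covers E x y → Covers (E ᵒᵖ) y x
    coversᵒᵖ ((x≤y , x≢y) , nothing-between) =
      (x≤y , ≢-sym x≢y) ,
      λ z ((z≤y , y≢z) , (x≤z , z≢x)) → nothing-between z ((x≤z , ≢-sym z≢x) , (z≤y , ≢-sym y≢z))

  module EdgeDeleted (E : LabelledHeap P C) (S T : P) where

    IsST : P → P → Set
    IsST v w = (v ≡ S × w ≡ T) ⊎ (v ≡ T × w ≡ S)

    data SimplePath : P → ℕ → Set
    vertex : ∀ {x k} → SimplePath x k → Fin (suc k) → P

    data SimplePath where
      start : IsVertex E S → SimplePath S 0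
      cons  : ∀ {x y k} (p : SimplePath x k) → Edge E x y → ¬ IsST x y → IsVertex E y →
              (∀ i → vertex p i ≢ y) → SimplePath y (suc k)

    vertex (start _)                _       = S
    vertex (cons {y = y} _ _ _ _ _) zero    = y
    vertex (cons p _ _ _ _)         (suc i) = vertex p i

    vertex-zero : ∀ {x k} (p : SimplePath x k) → vertex p zero ≡ x
    vertex-zero (start _)        = refl
    vertex-zero (cons _ _ _ _ _) = refl

    vertex-last : ∀ {x k} (p : SimplePath x k) → vertex p (fromℕ k) ≡ S
    vertex-last (start _)        = refl
    vertex-last (cons p _ _ _ _) = vertex-last p

    vertex-injective : ∀ {x k} (p : SimplePath x k) {i j} → vertex p i ≡ vertex p j → i ≡ j
    vertex-injective (start _)            {zero}  {zero}  _  = refl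
    vertex-injective (cons _ _ _ _ _)     {zero}  {zero}  _  = refl
    vertex-injective (cons _ _ _ _ fresh) {zero}  {suc j} eq = ⊥-elim (fresh j (sym eq))
    vertex-injective (cons _ _ _ _ fresh) {suc i} {zero}  eq = ⊥-elim (fresh i eq)
    vertex-injective (cons p _ _ _ _)     {suc i} {suc j} eq = cong suc (vertex-injective p eq)

    vertex-isVertex : ∀ {x k} (p : SimplePath x k) i → IsVertex E (vertex p i)
    vertex-isVertex (start S∈E)        _       = S∈E
    vertex-isVertex (cons _ _ _ y∈E _) zero    = y∈E
    vertex-isVertex (cons p _ _ _ _)   (suc i) = vertex-isVertex p i

    vertex-edge : ∀ {x k} (p : SimplePath x (suc k)) (i : Fin (suc k)) →
                  Edge E (vertex p (inject₁ i)) (vertex p (suc i))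
    vertex-edge (cons q xy _ _ _)                 zero    =
      subst (Edge E _) (sym (vertex-zero q)) (Edge-sym E xy)
    vertex-edge (cons q@(cons _ _ _ _ _) _ _ _ _) (suc i) = vertex-edge q i

    Reachable : P → Set
    Reachable x = ∃ (SimplePath x)

    prefix : ∀ {x k} (p : SimplePath x k) i → Reachable (vertex p i)
    prefix p@(start _)        zero    = _ , p
    prefix p@(cons _ _ _ _ _) zero    = _ , p
    prefix (cons p _ _ _ _)   (suc i) = prefix p i

    -- Labels need not have decidable equality, but under ¬ ¬ we may still ask whether
    -- y lies on the path: if so cut the path there, otherwise append y.
    reachable-step : ∀ {x y} → Reachable x → C x y → ¬ IsST x y → IsVertex E y → ¬ ¬ Reachable y
    reachable-step {x} {y} (_ , p) xCy not-ST y∈E = ¬¬-map extend ¬¬-excluded-middle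
      where
      extend : Dec (∃ λ i → vertex p i ≡ y) → Reachable y
      extend (yes (i , refl)) = prefix p i
      extend (no y∉p) = _ , cons p (x≢y , xCy) not-ST y∈E (λ i eq → y∉p (i , eq))
        where
        x≢y : x ≢ y
        x≢y x≡y = y∉p (zero , trans (vertex-zero p) x≡y)

    unreachable : NoCircuits E → Edge E S T → ¬ Reachable T
    unreachable _       (S≢T , _) (_ , start _)                     = S≢T refl
    unreachable _       _         (_ , cons (start _) _ not-ST _ _) = not-ST (inj₁ (refl , refl))
    unreachable acyclic ST (_ , p@(cons {k = suc m} q@(cons _ _ _ _ _) _ _ _ _)) = acyclic m record
      { v        = vertex p
      ; distinct = vertex-injective p
      ; vertex   = vertex-isVertex p
      ; step     = vertex-edge p
      ; close    = subst (λ w → Edge E w T) (sym (vertex-last q)) ST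
      }

    open IsPartialOrder (isPartialOrder E) using () renaming (refl to ≤-refl; trans to ≤-trans)

    Avoids : Fin (n E) → Fin (n E) → Set
    Avoids x y = ∀ {u v} → _≤_ E x u → _≤_ E u v → _≤_ E v y → ¬ IsST (ε E u) (ε E v)

    reachable-closure : ∀ {x y} → TransClosure (λ u v → _≤_ E u v × C (ε E u) (ε E v)) x y →
                        Avoids x y → Reachable (ε E x) → ¬ ¬ Reachable (ε E y)
    reachable-closure [ x≤y , xCy ] avoids ρ =
      reachable-step ρ xCy (avoids ≤-refl x≤y ≤-refl) (_ , refl)
    reachable-closure ((x≤w , xCw) ∷ rest) avoids ρ =
      reachable-step ρ xCw (avoids ≤-refl x≤w (closure⇒≤ E rest)) (_ , refl) >>=
      reachable-closure rest (avoids ∘ ≤-trans x≤w)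

    reachable-along : ∀ {x y} → _≤_ E x y → Avoids x y → Reachable (ε E x) → ¬ ¬ Reachable (ε E y)
    reachable-along = reachable-closure ∘ ≤⇒closure E

  module _ (E : LabelledHeap P C) (acyclic : NoCircuits E) {a b} (balanced : MinimalBalanced E a b)
           {a'} (a'∈S : InS E a b a')
           (a'-least : ∀ x → InS E a b x → ε E x ≡ ε E a' → ¬ (_<_ E x a')) where

    open IsPartialOrder (isPartialOrder E) using (antisym) renaming (trans to ≤-trans)
    open EdgeDeleted E (ε E a) (ε E a')

    private
      εa≡εb : ε E a ≡ ε E b
      εa≡εb = proj₁ (proj₂ (proj₂ balanced))

      only-ends : ∀ c → _≤_ E a c → _≤_ E c b → ε E c ≡ ε E a → c ≡ a ⊎ c ≡ b
      only-ends = proj₂ (proj₂ (proj₂ balanced))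

      a≤a' : _≤_ E a a'
      a≤a' = proj₁ a'∈S

      a'≤b : _≤_ E a' b
      a'≤b = proj₁ (proj₂ a'∈S)

      εa'≢εa : ε E a' ≢ ε E a
      εa'≢εa = proj₁ (proj₂ (proj₂ a'∈S))

      εaCεa' : C (ε E a) (ε E a')
      εaCεa' = proj₂ (proj₂ (proj₂ a'∈S))

    a-unique : ∀ {u} → _≤_ E a u → _≤_ E u a' → ε E u ≡ ε E a → u ≡ a
    a-unique {u} a≤u u≤a' εu≡εa with only-ends u a≤u (≤-trans u≤a' a'≤b) εu≡εa
    ... | inj₁ u≡a = u≡a
    ... | inj₂ refl = ⊥-elim (εa'≢εa (trans (cong (ε E) (antisym a'≤b u≤a')) (sym εa≡εb)))

    a'-unique : ∀ {u} → _≤_ E a u → _≤_ E u a' → ε E u ≡ ε E a' → u ≡ a'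
    a'-unique {u} a≤u u≤a' εu≡εa' with u ≟ a'
    ... | yes u≡a' = u≡a'
    ... | no u≢a' = ⊥-elim (a'-least u u∈S εu≡εa' (u≤a' , u≢a'))
      where
      u∈S : InS E a b u
      u∈S = a≤u , ≤-trans u≤a' a'≤b , (εa'≢εa ∘ trans (sym εu≡εa')) ,
            subst (C (ε E a)) (sym εu≡εa') εaCεa'

    ST-step : ∀ {u v} → _≤_ E a u → _≤_ E u v → _≤_ E v a' → IsST (ε E u) (ε E v) → u ≡ a × v ≡ a'
    ST-step a≤u u≤v v≤a' (inj₁ (εu≡εa , εv≡εa')) =
      a-unique a≤u (≤-trans u≤v v≤a') εu≡εa , a'-unique (≤-trans a≤u u≤v) v≤a' εv≡εa'
    ST-step a≤u u≤v v≤a' (inj₂ (εu≡εa' , εv≡εa))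
      with a'-unique a≤u (≤-trans u≤v v≤a') εu≡εa' | a-unique (≤-trans a≤u u≤v) v≤a' εv≡εa
    ... | refl | refl = ⊥-elim (εa'≢εa (cong (ε E) (antisym u≤v a≤a')))

    avoids-below : ∀ {z} → _<_ E z a' → Avoids a z
    avoids-below (z≤a' , z≢a') a≤u u≤v v≤z isST with ST-step a≤u u≤v (≤-trans v≤z z≤a') isST
    ... | _ , refl = z≢a' (antisym z≤a' v≤z)

    avoids-above : ∀ {z} → _<_ E a z → Avoids z a'
    avoids-above (a≤z , a≢z) z≤u u≤v v≤a' isST with ST-step (≤-trans a≤z z≤u) u≤v v≤a' isST
    ... | refl , _ = a≢z (antisym a≤z z≤u)

    covers-least : Covers E a a'
    covers-least = (a≤a' , εa'≢εa ∘ cong (ε E) ∘ sym) , λ z (a<z , z<a') →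
      (reachable-along (proj₁ a<z) (avoids-below z<a') (0 , start (a , refl)) >>=
       reachable-along (proj₁ z<a') (avoids-above a<z))
      (unreachable acyclic (≢-sym εa'≢εa , εaCεa'))

lemma3p3p5 : {P : Set} {C : P → P → Set} → Reflexive C → Symmetric C →
    (E : LabelledHeap P C) → NoCircuits E →
    ∀ a b → MinimalBalanced E a b →
    ∀ c → InS E a b c →
    ∀ a' → InS E a b a' → ε E a' ≡ ε E c →
      (∀ x → InS E a b x → ε E x ≡ ε E c → ¬ (_<_ E x a')) →
    ∀ b' → InS E a b b' → ε E b' ≡ ε E c →
      (∀ x → InS E a b x → ε E x ≡ ε E c → ¬ (_<_ E b' x)) →
    Covers E a a' × Covers E b' b
lemma3p3p5 _ C-sym E acyclic a b balanced _ _ a' a'∈S εa'≡εc a'-least b' b'∈S εb'≡εc b'-greatest =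
  covers-least E acyclic balanced a'∈S (λ x x∈S εx≡εa' → a'-least x x∈S (trans εx≡εa' εa'≡εc)) ,
  coversᵒᵖ (E ᵒᵖ) (covers-least (E ᵒᵖ) (noCircuitsᵒᵖ E acyclic) (minimalBalancedᵒᵖ E balanced)
                                (inSᵒᵖ E εa≡εb b'∈S) b'-greatestᵒᵖ)
  where
  open Heaps C-sym
  εa≡εb : ε E a ≡ ε E b
  εa≡εb = proj₁ (proj₂ (proj₂ balanced))
  b'-greatestᵒᵖ : ∀ x → InS (E ᵒᵖ) b a x → ε E x ≡ ε E b' → ¬ (_<_ (E ᵒᵖ) x b')
  b'-greatestᵒᵖ x x∈S εx≡εb' (b'≤x , x≢b') =
    b'-greatest x (inSᵒᵖ (E ᵒᵖ) (sym εa≡εb) x∈S) (trans εx≡εb' εb'≡εc) (b'≤x , ≢-sym x≢b')
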